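{- Let $G$ be a finite simple graph and let $\kappa(G)$ be the number of vertices not contained in any cycle of $G$. Then \[\mathrm{girth}(G)-1+\kappa(G)\leq ir_{cy}(G),\] where $\mathrm{girth}(G)=1$ if $G$ is a forest and otherwise $\mathrm{girth}(G)$ is the length of a shortest cycle.
   Context: For $S\subseteq V$, $\langle S\rangle$ is the induced subgraph. $S$ is cycle irredundant if for every $u\in S$, either $u$ is not contained in any cycle of $\langle S\rangle$, or there exists $v\in V\setminus S$ such that $v$ is contained in a cycle of $\langle S\cup\{v\}\rangle$ but not in any cycle of $\langle (S\setminus\{u\})\cup\{v\}\rangle$. $ir_{cy}(G)$ is the minimum size of a maximal cycle irredundant set (a cycle irredundant set with no cycle irredundant proper superset). -}

module Defs where

open import Level using (0ℓ)
open import Data.Nat using (ℕ; suc; _≤_)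
open import Data.Fin using (Fin)
open import Data.Fin.Subset using (Subset; _∈_; _∉_; _∪_; _-_; ⁅_⁆; _⊂_; ∣_∣)
open import Data.List using (List; _∷_; _∷ʳ_; length)
open import Data.List.Relation.Unary.All using (All)
open import Data.List.Relation.Unary.Linked using (Linked)
open import Data.List.Relation.Unary.Unique.Propositional using (Unique)
import Data.List.Membership.Propositional as LMem
open import Data.Product using (Σ; ∃; _×_)
open import Data.Sum using (_⊎_)
open import Data.Empty using (⊥)
open import Relation.Nullary using (¬_)
open import Relation.Binary.PropositionalEquality using (_≡_)
open import Function.Bundles using (_⇔_)

record Graph : Set₁ where
  field
    n      : ℕ
    Adj    : Fin n → Fin n → Set
    sym    : ∀ {x y} → Adj x y → Adj y x
    irrefl : ∀ {x} → ¬ Adj x x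

module _ (G : Graph) where
  open Graph G

  record Cycle : Set where
    field
      first    : Fin n
      rest     : List (Fin n)
      long     : 2 ≤ length rest
      distinct : Unique (first ∷ rest)
      closed   : Linked Adj ((first ∷ rest) ∷ʳ first)

    vertices : List (Fin n)
    vertices = first ∷ rest

    len : ℕ
    len = suc (length rest)

  open Cycle

  OnCycle : Fin n → Set
  OnCycle v = Σ Cycle λ c → v LMem.∈ vertices c

  -- c is a cycle of the induced subgraph ⟨T⟩ (all its vertices lie in T)
  CycleIn : Subset n → Cycle → Set
  CycleIn T c = All (_∈ T) (vertices c)

  OnCycleIn : Subset n → Fin n → Set
  OnCycleIn T v = Σ Cycle λ c → CycleIn T c × v LMem.∈ vertices c

  CycleIrredundant : Subset n → Set
  CycleIrredundant S =
    ∀ u → u ∈ S →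
      ¬ OnCycleIn S u
      ⊎ ∃ λ v → v ∉ S × OnCycleIn (S ∪ ⁅ v ⁆) v × ¬ OnCycleIn ((S - u) ∪ ⁅ v ⁆) v

  MaximalCycleIrredundant : Subset n → Set
  MaximalCycleIrredundant S =
    CycleIrredundant S × (∀ T → S ⊂ T → ¬ CycleIrredundant T)

  IsGirth : ℕ → Set
  IsGirth g =
    ((Cycle → ⊥) × g ≡ 1)
    ⊎ (Σ Cycle λ c → len c ≡ g × (∀ c′ → g ≤ len c′))

  IsKappa : ℕ → Set
  IsKappa k = Σ (Subset n) λ K → (∀ v → (v ∈ K) ⇔ (¬ OnCycle v)) × ∣ K ∣ ≡ k

-- A vertex on no cycle of G lies on no cycle of any induced subgraph, so adding it to a
-- cycle irredundant set changes none of the cycle conditions; hence a maximal cycle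
-- irredundant set S contains all κ(G) such vertices. Let C be a shortest cycle, of length g.
-- If C lies inside S, its g vertices and the κ(G) acyclic vertices are disjoint parts of S.
-- Otherwise pick w ∈ C outside S: by maximality S ∪ {w} is not cycle irredundant, so it
-- induces a cycle, of length at least g and again disjoint from the acyclic vertices, whence
-- ∣S∣ + 1 ≥ g + κ(G).
module Submission where

open import Defs
open import Data.Nat using (ℕ; suc; z≤n; s≤s; _+_; _∸_; _≤_; _≤?_)
open import Data.Nat.Properties
  using (+-comm; +-suc; ≤-trans; ≤-reflexive; n≤1+n; +-monoʳ-≤; +-monoˡ-≤; +-monoʳ-<; <-irrefl; ≰⇒>; module ≤-Reasoning)
open import Data.Fin using (Fin)
open import Data.Fin.Subset using (Subset; ∣_∣; _∈_; _∉_; _∪_; _─_; _-_; ⁅_⁆; _⊂_; _⊆_; inside; outside)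
open import Data.Fin.Subset.Properties
  using (_∈?_; x∈p∪q⁺; x∈p∪q⁻; p⊆p∪q; x∈⁅x⁆; x∈⁅y⁆⇒x≡y; x∈p∧x∉q⇒x∈p─q; p─q⊆p; ∣⁅x⁆∣≡1; p⊆q⇒∣p∣≤∣q∣; p⊂q⇒∣p∣<∣q∣; ∪-assoc; ∪-comm; ⊆-trans; ⊆-reflexive)
open import Data.List using (List; []; _∷_; length)
open import Data.List.Relation.Unary.All as All using (All; _∷_)
open import Data.List.Relation.Unary.All.Properties using (¬All⇒Any¬)
open import Data.List.Relation.Unary.Any using (satisfied)
open import Data.List.Relation.Unary.AllPairs using (_∷_)
open import Data.List.Relation.Unary.Unique.Propositional using (Unique)
open import Data.Product using (_,_; proj₁)
open import Data.Sum using (inj₁; inj₂)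
open import Data.Empty using (⊥-elim)
open import Data.Vec using ([]; _∷_; here; there)
open import Relation.Nullary using (¬_; yes; no)
open import Relation.Nullary.Decidable using (decidable-stable)
open import Relation.Binary.PropositionalEquality using (_≡_; _≢_; refl; sym; cong; subst; module ≡-Reasoning)
open import Function.Bundles using (Equivalence)
open import Function using (_∘_; case_of_)

private
  variable
    m : ℕ

x∈p─q⇒x∉q : ∀ (p q : Subset m) {x} → x ∈ p ─ q → x ∉ q
x∈p─q⇒x∉q (inside ∷ p) (outside ∷ q) here ()
x∈p─q⇒x∉q (_ ∷ p) (_ ∷ q) (there x∈p─q) (there x∈q) = x∈p─q⇒x∉q p q x∈p─q x∈q

p∪q─r⊆p─r∪q : ∀ (p q r : Subset m) → (p ∪ q) ─ r ⊆ (p ─ r) ∪ q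
p∪q─r⊆p─r∪q p q r x∈p∪q─r with x∈p∪q⁻ p q (p─q⊆p (p ∪ q) r x∈p∪q─r)
... | inj₁ x∈p = x∈p∪q⁺ (inj₁ (x∈p∧x∉q⇒x∈p─q x∈p (x∈p─q⇒x∉q (p ∪ q) r x∈p∪q─r)))
... | inj₂ x∈q = x∈p∪q⁺ (inj₂ x∈q)

[p∪q]∪r≡[p∪r]∪q : ∀ (p q r : Subset m) → (p ∪ q) ∪ r ≡ (p ∪ r) ∪ q
[p∪q]∪r≡[p∪r]∪q p q r = begin
  (p ∪ q) ∪ r  ≡⟨ ∪-assoc p q r ⟩
  p ∪ (q ∪ r)  ≡⟨ cong (p ∪_) (∪-comm q r) ⟩
  p ∪ (r ∪ q)  ≡⟨ ∪-assoc p r q ⟨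
  (p ∪ r) ∪ q  ∎
  where open ≡-Reasoning

∪-lub : ∀ {p q r : Subset m} → p ⊆ r → q ⊆ r → p ∪ q ⊆ r
∪-lub {p = p} {q} p⊆r q⊆r x∈p∪q with x∈p∪q⁻ p q x∈p∪q
... | inj₁ x∈p = p⊆r x∈p
... | inj₂ x∈q = q⊆r x∈q

∪-monoˡ-⊆ : ∀ {p q : Subset m} r → p ⊆ q → p ∪ r ⊆ q ∪ r
∪-monoˡ-⊆ r p⊆q = ∪-lub (λ x∈p → x∈p∪q⁺ (inj₁ (p⊆q x∈p))) (λ x∈r → x∈p∪q⁺ (inj₂ x∈r))

∪-⁅⁆⊆ : ∀ {p q : Subset m} {x} → p ⊆ q → x ∈ q → p ∪ ⁅ x ⁆ ⊆ q
∪-⁅⁆⊆ {x = x} p⊆q x∈q = ∪-lub p⊆q (λ y∈⁅x⁆ → subst (_∈ _) (sym (x∈⁅y⁆⇒x≡y x y∈⁅x⁆)) x∈q)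

x∉p∪⁅y⁆ : ∀ {p : Subset m} {x y} → x ∉ p → y ≢ x → x ∉ p ∪ ⁅ y ⁆
x∉p∪⁅y⁆ {p = p} {y = y} x∉p y≢x x∈p∪⁅y⁆ with x∈p∪q⁻ p ⁅ y ⁆ x∈p∪⁅y⁆
... | inj₁ x∈p = x∉p x∈p
... | inj₂ x∈⁅y⁆ = y≢x (sym (x∈⁅y⁆⇒x≡y y x∈⁅y⁆))

p⊂p∪⁅x⁆ : ∀ {p : Subset m} {x} → x ∉ p → p ⊂ p ∪ ⁅ x ⁆
p⊂p∪⁅x⁆ {x = x} x∉p = p⊆p∪q ⁅ x ⁆ , x , x∈p∪q⁺ (inj₂ (x∈⁅x⁆ x)) , x∉p

∣p∪q∣≤∣p∣+∣q∣ : ∀ (p q : Subset m) → ∣ p ∪ q ∣ ≤ ∣ p ∣ + ∣ q ∣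
∣p∪q∣≤∣p∣+∣q∣ []            []            = z≤n
∣p∪q∣≤∣p∣+∣q∣ (outside ∷ p) (outside ∷ q) = ∣p∪q∣≤∣p∣+∣q∣ p q
∣p∪q∣≤∣p∣+∣q∣ (inside  ∷ p) (outside ∷ q) = s≤s (∣p∪q∣≤∣p∣+∣q∣ p q)
∣p∪q∣≤∣p∣+∣q∣ (outside ∷ p) (inside  ∷ q) =
  ≤-trans (s≤s (∣p∪q∣≤∣p∣+∣q∣ p q)) (≤-reflexive (sym (+-suc ∣ p ∣ ∣ q ∣)))
∣p∪q∣≤∣p∣+∣q∣ (inside  ∷ p) (inside  ∷ q) =
  s≤s (≤-trans (∣p∪q∣≤∣p∣+∣q∣ p q) (+-monoʳ-≤ ∣ p ∣ (n≤1+n ∣ q ∣)))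

∣p∣+length≤∣q∣ : ∀ {p q : Subset m} {xs : List (Fin m)} → p ⊆ q → Unique xs →
  All (_∈ q) xs → All (_∉ p) xs → ∣ p ∣ + length xs ≤ ∣ q ∣
∣p∣+length≤∣q∣ {p = p} {xs = []} p⊆q _ _ _ = ≤-trans (≤-reflexive (+-comm ∣ p ∣ 0)) (p⊆q⇒∣p∣≤∣q∣ p⊆q)
∣p∣+length≤∣q∣ {p = p} {q} {x ∷ xs} p⊆q (x∉xs ∷ xs!) (x∈q ∷ xs⊆q) (x∉p ∷ xs∉p) = begin
  ∣ p ∣ + suc (length xs)       ≡⟨ +-suc ∣ p ∣ (length xs) ⟩
  suc ∣ p ∣ + length xs         ≤⟨ +-monoˡ-≤ (length xs) (p⊂q⇒∣p∣<∣q∣ (p⊂p∪⁅x⁆ x∉p)) ⟩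
  ∣ p ∪ ⁅ x ⁆ ∣ + length xs     ≤⟨ ∣p∣+length≤∣q∣ (∪-⁅⁆⊆ p⊆q x∈q) xs! xs⊆q
                                    (All.zipWith (λ (x≢y , y∉p) → x∉p∪⁅y⁆ y∉p x≢y) (x∉xs , xs∉p)) ⟩
  ∣ q ∣                         ∎
  where open ≤-Reasoning

module _ (G : Graph) where
  open Graph G using (n)

  OffCycle : Fin n → Set
  OffCycle v = ¬ OnCycle G v

  CycleIn-mono : ∀ {X Y} → X ⊆ Y → ∀ c → CycleIn G X c → CycleIn G Y c
  CycleIn-mono X⊆Y _ = All.map X⊆Y

  CycleIn-∪-offCycle : ∀ X {u} → OffCycle u → ∀ c → CycleIn G (X ∪ ⁅ u ⁆) c → CycleIn G X c
  CycleIn-∪-offCycle X {u} u-off c c⊆X∪u = All.tabulate λ {y} y∈c →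
    case x∈p∪q⁻ X ⁅ u ⁆ (All.lookup c⊆X∪u y∈c) of λ
      { (inj₁ y∈X) → y∈X
      ; (inj₂ y∈⁅u⁆) → ⊥-elim (u-off (subst (OnCycle G) (x∈⁅y⁆⇒x≡y u y∈⁅u⁆) (c , y∈c))) }

  OnCycleIn⇒OnCycle : ∀ {X v} → OnCycleIn G X v → OnCycle G v
  OnCycleIn⇒OnCycle (c , _ , v∈c) = c , v∈c

  OnCycleIn-map : ∀ {X Y v} → (∀ c → CycleIn G X c → CycleIn G Y c) → OnCycleIn G X v → OnCycleIn G Y v
  OnCycleIn-map f (c , c⊆X , v∈c) = c , f c c⊆X , v∈c

  CycleIrredundant-∪-offCycle : ∀ {S u} → OffCycle u → CycleIrredundant G S → CycleIrredundant G (S ∪ ⁅ u ⁆)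
  CycleIrredundant-∪-offCycle {S} {u} u-off S-irr x x∈S∪u with x∈p∪q⁻ S ⁅ u ⁆ x∈S∪u
  ... | inj₂ x∈⁅u⁆ = inj₁ λ x-on →
    u-off (subst (OnCycle G) (x∈⁅y⁆⇒x≡y u x∈⁅u⁆) (OnCycleIn⇒OnCycle x-on))
  ... | inj₁ x∈S with S-irr x x∈S
  ...   | inj₁ x-off = inj₁ λ x-on → x-off (OnCycleIn-map (CycleIn-∪-offCycle S u-off) x-on)
  ...   | inj₂ (v , v∉S , v-on , v-off) =
    inj₂ (v , v∉S∪u , OnCycleIn-map grow v-on , λ v-on′ → v-off (OnCycleIn-map shrink v-on′))
    where
    v∉S∪u : v ∉ S ∪ ⁅ u ⁆
    v∉S∪u = x∉p∪⁅y⁆ v∉S λ u≡v → u-off (subst (OnCycle G) (sym u≡v) (OnCycleIn⇒OnCycle v-on))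

    grow : ∀ c → CycleIn G (S ∪ ⁅ v ⁆) c → CycleIn G ((S ∪ ⁅ u ⁆) ∪ ⁅ v ⁆) c
    grow = CycleIn-mono (∪-monoˡ-⊆ ⁅ v ⁆ (p⊆p∪q ⁅ u ⁆))

    shrink : ∀ c → CycleIn G (((S ∪ ⁅ u ⁆) - x) ∪ ⁅ v ⁆) c → CycleIn G ((S - x) ∪ ⁅ v ⁆) c
    shrink c = CycleIn-∪-offCycle ((S - x) ∪ ⁅ v ⁆) u-off c ∘ CycleIn-mono
      (⊆-trans (∪-monoˡ-⊆ ⁅ v ⁆ (p∪q─r⊆p─r∪q S ⁅ u ⁆ ⁅ x ⁆))
               (⊆-reflexive ([p∪q]∪r≡[p∪r]∪q (S - x) ⁅ u ⁆ ⁅ v ⁆))) c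

  acyclic⇒CycleIrredundant : ∀ {T} → (∀ c → ¬ CycleIn G T c) → CycleIrredundant G T
  acyclic⇒CycleIrredundant acyclic _ _ = inj₁ λ (c , c⊆T , _) → acyclic c c⊆T

  maximal⇒¬CycleIrredundant-∪ : ∀ {S u} → MaximalCycleIrredundant G S → u ∉ S →
    ¬ CycleIrredundant G (S ∪ ⁅ u ⁆)
  maximal⇒¬CycleIrredundant-∪ (_ , maximal) u∉S = maximal _ (p⊂p∪⁅x⁆ u∉S)

  offCycle∈maximal : ∀ {S u} → MaximalCycleIrredundant G S → OffCycle u → u ∈ S
  offCycle∈maximal {S} {u} S-max u-off with u ∈? S
  ... | yes u∈S = u∈S
  ... | no u∉S = ⊥-elim (maximal⇒¬CycleIrredundant-∪ S-max u∉S
                          (CycleIrredundant-∪-offCycle u-off (proj₁ S-max)))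

  ∣K∣+len≤∣T∣ : ∀ {K T} → K ⊆ T → (∀ {v} → v ∈ K → OffCycle v) →
    ∀ c → CycleIn G T c → ∣ K ∣ + Cycle.len c ≤ ∣ T ∣
  ∣K∣+len≤∣T∣ K⊆T K-off c c⊆T = ∣p∣+length≤∣q∣ K⊆T (Cycle.distinct c) c⊆T
    (All.tabulate λ y∈c y∈K → K-off y∈K (c , y∈c))

  shortestCycle-bound : ∀ {K S} → MaximalCycleIrredundant G S → K ⊆ S → (∀ {v} → v ∈ K → OffCycle v) →
    (c : Cycle G) → (∀ c′ → Cycle.len c ≤ Cycle.len c′) → Cycle.len c ∸ 1 + ∣ K ∣ ≤ ∣ S ∣
  shortestCycle-bound {K} {S} S-max K⊆S K-off c shortest with All.all? (_∈? S) (Cycle.vertices c)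
  ... | yes c⊆S = begin
    r + ∣ K ∣      ≡⟨ +-comm r ∣ K ∣ ⟩
    ∣ K ∣ + r      ≤⟨ +-monoʳ-≤ ∣ K ∣ (n≤1+n r) ⟩
    ∣ K ∣ + suc r  ≤⟨ ∣K∣+len≤∣T∣ K⊆S K-off c c⊆S ⟩
    ∣ S ∣          ∎
    where
    open ≤-Reasoning
    r = Cycle.len c ∸ 1
  ... | no c⊈S with satisfied (¬All⇒Any¬ (_∈? S) (Cycle.vertices c) c⊈S)
  ...   | w , w∉S = decidable-stable (r + ∣ K ∣ ≤? ∣ S ∣) λ r+K≰S →
    maximal⇒¬CycleIrredundant-∪ S-max w∉S (acyclic⇒CycleIrredundant λ c′ c′⊆T →
      <-irrefl refl (begin-strict
        r + ∣ K ∣               ≡⟨ +-comm r ∣ K ∣ ⟩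
        ∣ K ∣ + r               <⟨ +-monoʳ-< ∣ K ∣ (shortest c′) ⟩
        ∣ K ∣ + Cycle.len c′    ≤⟨ ∣K∣+len≤∣T∣ (⊆-trans K⊆S (p⊆p∪q ⁅ w ⁆)) K-off c′ c′⊆T ⟩
        ∣ S ∪ ⁅ w ⁆ ∣           ≤⟨ ∣p∪q∣≤∣p∣+∣q∣ S ⁅ w ⁆ ⟩
        ∣ S ∣ + ∣ ⁅ w ⁆ ∣       ≡⟨ cong (∣ S ∣ +_) (∣⁅x⁆∣≡1 w) ⟩
        ∣ S ∣ + 1               ≡⟨ +-comm ∣ S ∣ 1 ⟩
        suc ∣ S ∣               ≤⟨ ≰⇒> r+K≰S ⟩
        r + ∣ K ∣               ∎))
    where
    open ≤-Reasoning
    r = Cycle.len c ∸ 1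

mainTheorem12 : (G : Graph) (g k : ℕ) → IsGirth G g → IsKappa G k →
    (S : Subset (Graph.n G)) → MaximalCycleIrredundant G S →
      g ∸ 1 + k ≤ ∣ S ∣
mainTheorem12 G g k girth (K , K-spec , refl) S S-max = bound girth
  where
  K-off : ∀ {v} → v ∈ K → OffCycle G v
  K-off {v} = Equivalence.to (K-spec v)

  K⊆S : K ⊆ S
  K⊆S v∈K = offCycle∈maximal G S-max (K-off v∈K)

  bound : IsGirth G g → g ∸ 1 + ∣ K ∣ ≤ ∣ S ∣
  bound (inj₁ (_ , refl)) = p⊆q⇒∣p∣≤∣q∣ K⊆S
  bound (inj₂ (c , refl , shortest)) = shortestCycle-bound G S-max K⊆S K-off c shortest
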